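{- For every integer $i\ge 0$, each of the functions $t\mapsto d'_i(t)$ and $t\mapsto d''_i(t)$ (for integers $t\ge0$) is eventually polynomial of degree $i$; more precisely, there exist an integer $t_0$ and polynomials $p,q$ of degree $i$, each of the form $\binom{t}{i}+\sum_{0\le n<i}c_n\binom{t}{n}$ with constants $c_n$, such that $d'_i(t)=p(t)$ and $d''_i(t)=q(t)$ for all integers $t\ge t_0$.
   Context: Let $V$ be the set of pairs $(i,t)$ of integers with either $(i,t)=(0,0)$ or $0\le i\le t-1$. Define $d'_i(t)$ for $(i,t)\in V$ by: $d'_0(t)=1$ for all $t\ge 0$; $d'_{t-1}(t)=1$ for all $t\ge 3$; for all other $(i,t)\in V$ (i.e. $1\le i\le t-2$, or $(i,t)=(1,2)$), recursively in $t$: if $2i\le t$ then $d'_i(t)=2d'_{i-1}(t-1)+d'_i(t-1)-d'_{i-1}(t-2)$, and if $2i\ge t+1$ then $d'_i(t)=d'_{i-1}(t-1)+2d'_i(t-1)-d'_{i-1}(t-2)$. Set $d'_i(t)=0$ for $(i,t)\notin V$ (with $t\ge0$), and define $d''_i(t)=d'_{t-1-i}(t)$ for all $i\in\mathbb Z$, $t\ge 0$. A function $f$ defined on a set $S\subseteq\mathbb Z$ is eventually polynomial of degree $k$ if there is $n_0$ such that all $n\ge n_0$ lie in $S$ and $f$ restricted to $\{n\ge n_0\}$ is a polynomial function of degree $k$. -}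

module Defs where

open import Data.Nat as ℕ using (ℕ; zero; suc; _∸_; _<ᵇ_; _≤ᵇ_; _≡ᵇ_)
open import Data.Nat.Combinatorics using (_C_)
open import Data.Integer using (ℤ; +_; _+_; _-_; _*_)
open import Data.Fin using (Fin; zero; suc)
open import Data.Bool using (if_then_else_; _∧_)

-- d' i t  =  d'_i(t)  (integer valued, 0 outside V).
-- V = {(0,0)} ∪ {(i,t) : 0 ≤ i ≤ t-1}.
d′ : ℕ → ℕ → ℤ
d′ zero t = + 1
d′ (suc i) zero = + 0
d′ (suc i) (suc zero) = + 0
d′ (suc i) (suc (suc t)) =
  -- here i' = i+1, t' = t+2
  if ℕ._<ᵇ_ t i then + 0                         -- i' ≥ t' : not in V
  else if (i ≡ᵇ t) ∧ (1 ≤ᵇ t) then + 1           -- i' = t'-1 with t' ≥ 3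
  else if (i ℕ.+ i) ≤ᵇ t                         -- 2i' ≤ t'
    then (+ 2) * d′ i (suc t) + d′ (suc i) (suc t) - d′ i t
    else d′ i (suc t) + (+ 2) * d′ (suc i) (suc t) - d′ i t

d″ : ℕ → ℕ → ℤ
d″ i t = if i <ᵇ t then d′ (t ∸ 1 ∸ i) t else + 0

sumFin : (k : ℕ) → (Fin k → ℤ) → ℤ
sumFin zero f = + 0
sumFin (suc k) f = f zero + sumFin k (λ n → f (suc n))

binomPoly : (i : ℕ) → (Fin i → ℤ) → ℕ → ℤ
binomPoly i c t = + (t C i) + sumFin i (λ n → c n * + (t C Data.Fin.toℕ n))

module Submission where

-- The proof is an induction on i driven by one recurrence.  For large t both
-- f = d′ (i+1), g = d′ i  (the branch 2i′ ≤ t′ of the definition of d′_{i′}(t′)) and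
-- f = d″ (i+1), g = d″ i  (the branch 2i′ ≥ t′+1, via d″_i(t) = d′_{t-1-i}(t))
-- satisfy
--   f (t+2) = 2 g (t+1) + f (t+1) - g t ,
-- i.e. the forward difference of t ↦ f (t+1) is 2 g (t+1) - g t.  If g is
-- eventually binomial of degree i, then so is 2 g (t+1) - g t (its leading
-- coefficient is 2 - 1 = 1), hence by summation f (t+1), and by a shift f
-- itself, is eventually binomial of degree i+1.

open import Defs
open import Data.Nat using (ℕ; _≤_)
open import Data.Integer using (ℤ)
open import Data.Fin using (Fin)
open import Data.Product using (∃-syntax; _×_)
open import Relation.Binary.PropositionalEquality using (_≡_)

import Data.Nat as ℕ
open import Data.Nat using (zero; suc; _∸_; _<_; _⊔_; _<ᵇ_; _≤ᵇ_; _≡ᵇ_; _≤′_; ≤′-refl; ≤′-step; s≤s)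
import Data.Nat.Properties as ℕP
open import Data.Nat.Combinatorics using (_C_; nCk+nC[k+1]≡[n+1]C[k+1])
open import Data.Integer using (+_; _+_; _-_; _*_; -_)
import Data.Integer.Properties as ℤP
open import Data.Integer.Solver using (module +-*-Solver)
open import Data.Fin using (zero; suc; toℕ)
open import Data.Vec.Functional using (_∷_; tail)
open import Data.Bool using (true; false; T; if_then_else_)
open import Data.Bool.Properties using (T-≡)
open import Data.Product using (_,_)
open import Function.Bundles using (Equivalence)
open import Relation.Nullary using (¬_)
open import Data.Empty using (⊥-elim)
open import Relation.Binary.PropositionalEquality using (refl; sym; trans; cong; cong₂; subst; module ≡-Reasoning)
open +-*-Solver using (solve; _:+_; _:-_; _:*_; _:=_; con)
open ≡-Reasoning

sumFin-cong : ∀ k {f g : Fin k → ℤ} → (∀ n → f n ≡ g n) → sumFin k f ≡ sumFin k g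
sumFin-cong zero    f≡g = refl
sumFin-cong (suc k) f≡g = cong₂ _+_ (f≡g zero) (sumFin-cong k (λ n → f≡g (suc n)))

sumFin-+ : ∀ k (f g : Fin k → ℤ) → sumFin k (λ n → f n + g n) ≡ sumFin k f + sumFin k g
sumFin-+ zero    f g = refl
sumFin-+ (suc k) f g = begin
    (f zero + g zero) + sumFin k (λ n → f (suc n) + g (suc n))
  ≡⟨ cong (_+_ (f zero + g zero)) (sumFin-+ k (tail f) (tail g)) ⟩
    (f zero + g zero) + (sumFin k (tail f) + sumFin k (tail g))
  ≡⟨ solve 4 (λ a b c d → (a :+ b) :+ (c :+ d) := (a :+ c) :+ (b :+ d)) refl
       (f zero) (g zero) (sumFin k (tail f)) (sumFin k (tail g)) ⟩
    (f zero + sumFin k (tail f)) + (g zero + sumFin k (tail g))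
  ∎

sumFin-* : ∀ k a (f : Fin k → ℤ) → sumFin k (λ n → a * f n) ≡ a * sumFin k f
sumFin-* zero    a f = sym (ℤP.*-zeroʳ a)
sumFin-* (suc k) a f = begin
    a * f zero + sumFin k (λ n → a * f (suc n))
  ≡⟨ cong (_+_ (a * f zero)) (sumFin-* k a (tail f)) ⟩
    a * f zero + a * sumFin k (tail f)
  ≡⟨ ℤP.*-distribˡ-+ a (f zero) (sumFin k (tail f)) ⟨
    a * (f zero + sumFin k (tail f))
  ∎

binom : ℕ → ℕ → ℤ
binom t n = + (t C n)

pascal : ∀ t n → binom (suc t) (suc n) ≡ binom t n + binom t (suc n)
pascal t n = cong +_ (sym (nCk+nC[k+1]≡[n+1]C[k+1] t n))

lowerPoly : (k : ℕ) → (Fin k → ℤ) → ℕ → ℤ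
lowerPoly k c t = sumFin k (λ n → c n * binom t (toℕ n))

lowerPoly⁺ : (k : ℕ) → (Fin k → ℤ) → ℕ → ℤ
lowerPoly⁺ k c t = sumFin k (λ n → c n * binom t (suc (toℕ n)))

lowerPoly⁺-step : ∀ k c t → lowerPoly⁺ k c (suc t) ≡ lowerPoly k c t + lowerPoly⁺ k c t
lowerPoly⁺-step k c t = begin
    sumFin k (λ n → c n * binom (suc t) (suc (toℕ n)))
  ≡⟨ sumFin-cong k (λ n → trans (cong (c n *_) (pascal t (toℕ n)))
                                (ℤP.*-distribˡ-+ (c n) _ _)) ⟩
    sumFin k (λ n → c n * binom t (toℕ n) + c n * binom t (suc (toℕ n)))
  ≡⟨ sumFin-+ k _ _ ⟩
    lowerPoly k c t + lowerPoly⁺ k c t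
  ∎

binomPoly-Δ : ∀ i (c : Fin (suc i) → ℤ) t →
  binomPoly (suc i) c (suc t) ≡ binomPoly (suc i) c t + binomPoly i (tail c) t
binomPoly-Δ i c t = begin
    binom (suc t) (suc i) + (c₀ + lowerPoly⁺ i (tail c) (suc t))
  ≡⟨ cong₂ (λ x y → x + (c₀ + y)) (pascal t i) (lowerPoly⁺-step i (tail c) t) ⟩
    (binom t i + binom t (suc i)) + (c₀ + (lowerPoly i (tail c) t + lowerPoly⁺ i (tail c) t))
  ≡⟨ solve 5 (λ b b' a l l' → (b :+ b') :+ (a :+ (l :+ l')) := (b' :+ (a :+ l')) :+ (b :+ l)) refl
       (binom t i) (binom t (suc i)) c₀ (lowerPoly i (tail c) t) (lowerPoly⁺ i (tail c) t) ⟩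
    (binom t (suc i) + (c₀ + lowerPoly⁺ i (tail c) t)) + (binom t i + lowerPoly i (tail c) t)
  ∎
  where c₀ = c zero * + 1

binomPoly-∷ : ∀ i a (c : Fin i → ℤ) t →
  binomPoly (suc i) (a ∷ c) t ≡ a + binomPoly (suc i) (+ 0 ∷ c) t
binomPoly-∷ i a c t =
  solve 3 (λ a b r → b :+ (a :* con (+ 1) :+ r) := a :+ (b :+ (con (+ 0) :* con (+ 1) :+ r))) refl
    a (binom t (suc i)) (lowerPoly⁺ i c t)

-- Coefficients (d₀, …, d_{j-1}, 1): a binomial polynomial of degree j seen
-- as a lower-order part of degree j+1.
monicCoeffs : ∀ j → (Fin j → ℤ) → Fin (suc j) → ℤ
monicCoeffs zero    d zero    = + 1
monicCoeffs (suc j) d zero    = d zero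
monicCoeffs (suc j) d (suc n) = monicCoeffs j (tail d) n

-- Stated for an arbitrary sequence b in place of n ↦ (t choose n), since the
-- induction shifts that sequence.
monicCoeffs-sum : ∀ j d (b : ℕ → ℤ) →
  sumFin (suc j) (λ n → monicCoeffs j d n * b (toℕ n)) ≡ b j + sumFin j (λ n → d n * b (toℕ n))
monicCoeffs-sum zero    d b = solve 1 (λ x → con (+ 1) :* x :+ con (+ 0) := x :+ con (+ 0)) refl (b 0)
monicCoeffs-sum (suc j) d b = begin
    d zero * b 0 + sumFin (suc j) (λ n → monicCoeffs j (tail d) n * b (suc (toℕ n)))
  ≡⟨ cong (_+_ (d zero * b 0)) (monicCoeffs-sum j (tail d) (λ n → b (suc n))) ⟩
    d zero * b 0 + (b (suc j) + rest)
  ≡⟨ solve 3 (λ x y z → x :+ (y :+ z) := y :+ (x :+ z)) refl (d zero * b 0) (b (suc j)) rest ⟩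
    b (suc j) + (d zero * b 0 + rest)
  ∎
  where rest = sumFin j (λ n → d (suc n) * b (suc (toℕ n)))

absorb : ∀ j → (Fin (suc j) → ℤ) → ℤ → (Fin j → ℤ) → Fin (suc j) → ℤ
absorb j c k d n = c n + k * monicCoeffs j d n

binomPoly-absorb : ∀ j c k d t →
  binomPoly (suc j) c t + k * binomPoly j d t ≡ binomPoly (suc j) (absorb j c k d) t
binomPoly-absorb j c k d t = begin
    binom t (suc j) + lowerPoly (suc j) c t + k * binomPoly j d t
  ≡⟨ cong (λ x → binom t (suc j) + lowerPoly (suc j) c t + k * x)
          (sym (monicCoeffs-sum j d (binom t))) ⟩
    binom t (suc j) + lowerPoly (suc j) c t + k * lowerPoly (suc j) m t
  ≡⟨ ℤP.+-assoc (binom t (suc j)) (lowerPoly (suc j) c t) (k * lowerPoly (suc j) m t) ⟩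
    binom t (suc j) + (lowerPoly (suc j) c t + k * lowerPoly (suc j) m t)
  ≡⟨ cong (λ x → binom t (suc j) + (lowerPoly (suc j) c t + x))
          (sym (sumFin-* (suc j) k (λ n → m n * binom t (toℕ n)))) ⟩
    binom t (suc j) + (lowerPoly (suc j) c t + sumFin (suc j) (λ n → k * (m n * binom t (toℕ n))))
  ≡⟨ cong (_+_ (binom t (suc j))) (sym (sumFin-+ (suc j) (λ n → c n * binom t (toℕ n)) (λ n → k * (m n * binom t (toℕ n))))) ⟩
    binom t (suc j) + sumFin (suc j) (λ n → c n * binom t (toℕ n) + k * (m n * binom t (toℕ n)))
  ≡⟨ cong (_+_ (binom t (suc j))) (sumFin-cong (suc j) (λ n →
       solve 4 (λ a b k' e → a :* b :+ k' :* (e :* b) := (a :+ k' :* e) :* b) refl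
         (c n) (binom t (toℕ n)) k (m n))) ⟩
    binomPoly (suc j) (absorb j c k d) t
  ∎
  where m = monicCoeffs j d

binomPoly-unshift : ∀ k (e : Fin k → ℤ) → ∃[ e′ ] (∀ t → binomPoly k e t ≡ binomPoly k e′ (suc t))
binomPoly-unshift zero    e = e , λ t → refl
binomPoly-unshift (suc j) e with binomPoly-unshift j (tail e)
... | e″ , q≡q′ = absorb j e (- + 1) e″ , λ t → begin
    p t
  ≡⟨ solve 2 (λ x y → x := (x :+ y) :+ con (- + 1) :* y) refl (p t) (q t) ⟩
    (p t + q t) + - + 1 * q t
  ≡⟨ cong₂ (λ x y → x + - + 1 * y) (sym (binomPoly-Δ j e t)) (q≡q′ t) ⟩
    p (suc t) + - + 1 * binomPoly j e″ (suc t)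
  ≡⟨ binomPoly-absorb j e (- + 1) e″ (suc t) ⟩
    binomPoly (suc j) (absorb j e (- + 1) e″) (suc t)
  ∎
  where
  p = binomPoly (suc j) e
  q = binomPoly j (tail e)

-- 2 p (t+1) - p t = p t + 2 Δp t is again monic of the same degree.
binomPoly-2shift : ∀ i (c : Fin i → ℤ) → ∃[ c′ ] (∀ t → + 2 * binomPoly i c (suc t) - binomPoly i c t ≡ binomPoly i c′ t)
binomPoly-2shift zero    c = c , λ t → refl
binomPoly-2shift (suc j) c = absorb j c (+ 2) (tail c) , λ t → begin
    + 2 * p (suc t) - p t
  ≡⟨ cong (λ x → + 2 * x - p t) (binomPoly-Δ j c t) ⟩
    + 2 * (p t + q t) - p t
  ≡⟨ solve 2 (λ x y → con (+ 2) :* (x :+ y) :- x := x :+ con (+ 2) :* y) refl (p t) (q t) ⟩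
    p t + + 2 * q t
  ≡⟨ binomPoly-absorb j c (+ 2) (tail c) t ⟩
    binomPoly (suc j) (absorb j c (+ 2) (tail c)) t
  ∎
  where
  p = binomPoly (suc j) c
  q = binomPoly j (tail c)

Eventually : (ℕ → Set) → Set
Eventually P = ∃[ T ] (∀ t → T ≤ t → P t)

eventually-map : ∀ {P Q : ℕ → Set} → (∀ t → P t → Q t) → Eventually P → Eventually Q
eventually-map P⇒Q (T , p) = T , λ t T≤t → P⇒Q t (p t T≤t)

eventually-× : ∀ {P Q : ℕ → Set} → Eventually P → Eventually Q → Eventually (λ t → P t × Q t)
eventually-× (T₁ , p) (T₂ , q) =
  T₁ ⊔ T₂ , λ t le → p t (ℕP.≤-trans (ℕP.m≤m⊔n T₁ T₂) le) , q t (ℕP.≤-trans (ℕP.m≤n⊔m T₁ T₂) le)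

induction-from : ∀ (P : ℕ → Set) T → P T → (∀ t → T ≤ t → P t → P (suc t)) → ∀ t → T ≤ t → P t
induction-from P T base step t T≤t = go (ℕP.≤⇒≤′ T≤t)
  where
  go : ∀ {t} → T ≤′ t → P t
  go ≤′-refl        = base
  go (≤′-step T≤′t) = step _ (ℕP.≤′⇒≤ T≤′t) (go T≤′t)

EventuallyBinomial : ℕ → (ℕ → ℤ) → Set
EventuallyBinomial i f = ∃[ c ] Eventually (λ t → f t ≡ binomPoly i c t)

evBinom-resp : ∀ {i} {f g : ℕ → ℤ} → Eventually (λ t → f t ≡ g t) →
  EventuallyBinomial i g → EventuallyBinomial i f
evBinom-resp f≈g (c , g≈p) = c , eventually-map (λ _ (f≡g , g≡p) → trans f≡g g≡p) (eventually-× f≈g g≈p)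

evBinom-unshift : ∀ {k} {f : ℕ → ℤ} → EventuallyBinomial k (λ t → f (suc t)) → EventuallyBinomial k f
evBinom-unshift {k} {f} (c , T , f₊≡p) with binomPoly-unshift k c
... | c′ , p≡p₊ = c′ , suc T , λ { (suc t) (s≤s T≤t) → trans (f₊≡p t T≤t) (p≡p₊ t) }

evBinom-2shift : ∀ {i} {g : ℕ → ℤ} → EventuallyBinomial i g →
  EventuallyBinomial i (λ t → + 2 * g (suc t) - g t)
evBinom-2shift {i} {g} (c , T , g≡p) with binomPoly-2shift i c
... | c′ , 2shift = c′ , T , λ t T≤t →
  trans (cong₂ (λ x y → + 2 * x - y) (g≡p (suc t) (ℕP.m≤n⇒m≤1+n T≤t)) (g≡p t T≤t)) (2shift t)

evBinom-sum : ∀ {i} {F : ℕ → ℤ} → EventuallyBinomial i (λ t → F (suc t) - F t) →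
  EventuallyBinomial (suc i) F
evBinom-sum {i} {F} (c , T , ΔF≡p) = e , T , induction-from (λ t → F t ≡ binomPoly (suc i) e t) T base step
  where
  offset = F T - binomPoly (suc i) (+ 0 ∷ c) T
  e = offset ∷ c
  base : F T ≡ binomPoly (suc i) e T
  base = begin
      F T
    ≡⟨ solve 2 (λ f x → f := (f :- x) :+ x) refl (F T) (binomPoly (suc i) (+ 0 ∷ c) T) ⟩
      offset + binomPoly (suc i) (+ 0 ∷ c) T
    ≡⟨ binomPoly-∷ i offset c T ⟨
      binomPoly (suc i) e T
    ∎
  step : ∀ t → T ≤ t → F t ≡ binomPoly (suc i) e t → F (suc t) ≡ binomPoly (suc i) e (suc t)
  step t T≤t F≡q = begin
      F (suc t)
    ≡⟨ solve 2 (λ x y → x := y :+ (x :- y)) refl (F (suc t)) (F t) ⟩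
      F t + (F (suc t) - F t)
    ≡⟨ cong₂ _+_ F≡q (ΔF≡p t T≤t) ⟩
      binomPoly (suc i) e t + binomPoly i c t
    ≡⟨ binomPoly-Δ i e t ⟨
      binomPoly (suc i) e (suc t)
    ∎

Recurrence : (ℕ → ℤ) → (ℕ → ℤ) → ℕ → Set
Recurrence f g t = f (suc (suc t)) ≡ + 2 * g (suc t) + f (suc t) - g t

recurrence-raises-degree : ∀ {i} {f g : ℕ → ℤ} → EventuallyBinomial i g →
  Eventually (Recurrence f g) → EventuallyBinomial (suc i) f
recurrence-raises-degree {f = f} {g} g-binomial recurrence =
  evBinom-unshift (evBinom-sum (evBinom-resp (eventually-map difference recurrence) (evBinom-2shift g-binomial)))
  where
  difference : ∀ t → Recurrence f g t → f (suc (suc t)) - f (suc t) ≡ + 2 * g (suc t) - g t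
  difference t rec = begin
      f (suc (suc t)) - f (suc t)
    ≡⟨ cong (_- f (suc t)) rec ⟩
      + 2 * g (suc t) + f (suc t) - g t - f (suc t)
    ≡⟨ solve 3 (λ a x y → a :+ x :- y :- x := a :- y) refl (+ 2 * g (suc t)) (f (suc t)) (g t) ⟩
      + 2 * g (suc t) - g t
    ∎

false-of-¬T : ∀ {b} → ¬ T b → b ≡ false
false-of-¬T {false} _  = refl
false-of-¬T {true}  ¬T = ⊥-elim (¬T _)

true-of-T : ∀ {b} → T b → b ≡ true
true-of-T = Equivalence.to T-≡

d′-off-diagonal : ∀ i t → i < t → d′ (suc i) (suc (suc t)) ≡
  (if (i ℕ.+ i) ≤ᵇ t then + 2 * d′ i (suc t) + d′ (suc i) (suc t) - d′ i t
                     else d′ i (suc t) + + 2 * d′ (suc i) (suc t) - d′ i t)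
d′-off-diagonal i t i<t
  rewrite false-of-¬T {t <ᵇ i} (λ t<ᵇi → ℕP.<⇒≱ (ℕP.<ᵇ⇒< t i t<ᵇi) (ℕP.<⇒≤ i<t))
        | false-of-¬T {i ≡ᵇ t} (λ i≡ᵇt → ℕP.<⇒≢ i<t (ℕP.≡ᵇ⇒≡ i t i≡ᵇt)) = refl

d′-lower : ∀ i t → suc (i ℕ.+ i) ≤ t → Recurrence (d′ (suc i)) (d′ i) t
d′-lower i t 2i<t
  rewrite d′-off-diagonal i t (ℕP.≤-trans (s≤s (ℕP.m≤m+n i i)) 2i<t)
        | true-of-T {(i ℕ.+ i) ≤ᵇ t} (ℕP.≤⇒≤ᵇ (ℕP.<⇒≤ 2i<t)) = refl

d′-upper : ∀ i t → i < t → t < i ℕ.+ i →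
  d′ (suc i) (suc (suc t)) ≡ d′ i (suc t) + + 2 * d′ (suc i) (suc t) - d′ i t
d′-upper i t i<t t<2i
  rewrite d′-off-diagonal i t i<t
        | false-of-¬T {(i ℕ.+ i) ≤ᵇ t} (λ 2i≤ᵇt → ℕP.<⇒≱ t<2i (ℕP.≤ᵇ⇒≤ (i ℕ.+ i) t 2i≤ᵇt)) = refl

d′-diagonal : ∀ t → d′ (suc (suc t)) (suc (suc (suc t))) ≡ + 1
d′-diagonal t
  rewrite false-of-¬T {suc t <ᵇ suc t} (λ t<ᵇt → ℕP.<-irrefl refl (ℕP.<ᵇ⇒< (suc t) (suc t) t<ᵇt))
        | true-of-T {suc t ≡ᵇ suc t} (ℕP.≡⇒≡ᵇ (suc t) (suc t) refl) = refl

d″-inside : ∀ {i t} → i ≤ t → d″ i (suc t) ≡ d′ (t ∸ i) (suc t)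
d″-inside {i} {t} i≤t rewrite true-of-T {i <ᵇ suc t} (ℕP.<⇒<ᵇ (s≤s i≤t)) = refl

-- For t ≥ 2i+2 the recurrence for d″ at t+1 is the upper-region recurrence
-- of d′ with index m = t - i.
d″-recurrence : ∀ i t → suc (suc i) ℕ.+ i ≤ t → Recurrence (d″ (suc i)) (d″ i) (suc t)
d″-recurrence i t le = begin
    d″ (suc i) (suc (suc (suc t)))
  ≡⟨ f₃ ⟩
    d′ (suc m) (suc (suc (suc t)))
  ≡⟨ d′-upper m (suc t) (s≤s (ℕP.m∸n≤m t i)) 1+t<2m ⟩
    d′ m (suc (suc t)) + + 2 * d′ (suc m) (suc (suc t)) - d′ m (suc t)
  ≡⟨ solve 3 (λ a b c → a :+ con (+ 2) :* b :- c := con (+ 2) :* b :+ a :- c) refl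
       (d′ m (suc (suc t))) (d′ (suc m) (suc (suc t))) (d′ m (suc t)) ⟩
    + 2 * d′ (suc m) (suc (suc t)) + d′ m (suc (suc t)) - d′ m (suc t)
  ≡⟨ cong₂ (λ x y → + 2 * x + y - d′ m (suc t)) g₂ f₂ ⟨
    + 2 * d″ i (suc (suc t)) + d″ (suc i) (suc (suc t)) - d′ m (suc t)
  ≡⟨ cong (λ z → + 2 * d″ i (suc (suc t)) + d″ (suc i) (suc (suc t)) - z) g₁ ⟨
    + 2 * d″ i (suc (suc t)) + d″ (suc i) (suc (suc t)) - d″ i (suc t)
  ∎
  where
  m = t ∸ i
  i≤t : i ≤ t
  i≤t = ℕP.m+n≤o⇒n≤o (suc (suc i)) le
  1+t∸i : suc t ∸ i ≡ suc m
  1+t∸i = ℕP.+-∸-assoc 1 i≤t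
  -- suc t = m + suc i < m + m, as suc i < m
  1+t<2m : suc t < m ℕ.+ m
  1+t<2m = subst (_< m ℕ.+ m) (trans (ℕP.+-suc m i) (cong suc (ℕP.m∸n+n≡m i≤t)))
                 (ℕP.+-monoʳ-< m (ℕP.m+n≤o⇒m≤o∸n (suc (suc i)) le))
  f₃ : d″ (suc i) (suc (suc (suc t))) ≡ d′ (suc m) (suc (suc (suc t)))
  f₃ = trans (d″-inside (s≤s (ℕP.m≤n⇒m≤1+n i≤t))) (cong (λ k → d′ k (suc (suc (suc t)))) 1+t∸i)
  g₂ : d″ i (suc (suc t)) ≡ d′ (suc m) (suc (suc t))
  g₂ = trans (d″-inside (ℕP.m≤n⇒m≤1+n i≤t)) (cong (λ k → d′ k (suc (suc t))) 1+t∸i)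
  f₂ : d″ (suc i) (suc (suc t)) ≡ d′ m (suc (suc t))
  f₂ = d″-inside (s≤s i≤t)
  g₁ : d″ i (suc t) ≡ d′ m (suc t)
  g₁ = d″-inside i≤t

-- Induction on i; the bases are d′_0 = 1 and d″_0(t) = d′_{t-1}(t) = 1 for t ≥ 3.
d′-binomial : ∀ i → EventuallyBinomial i (d′ i)
d′-binomial zero    = (λ ()) , 0 , λ t _ → refl
d′-binomial (suc i) = recurrence-raises-degree (d′-binomial i) (suc (i ℕ.+ i) , d′-lower i)

d″-binomial : ∀ i → EventuallyBinomial i (d″ i)
d″-binomial zero    = (λ ()) , 3 , λ { (suc (suc (suc t))) (s≤s (s≤s (s≤s _))) → d′-diagonal t }
d″-binomial (suc i) = recurrence-raises-degree (d″-binomial i)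
  (suc (suc (suc i) ℕ.+ i) , λ { (suc t) (s≤s le) → d″-recurrence i t le })

corollary2 : (i : ℕ) → ∃[ t₀ ] ∃[ c ] ∃[ e ]
    ((t : ℕ) → t₀ ≤ t → (d′ i t ≡ binomPoly i c t) × (d″ i t ≡ binomPoly i e t))
corollary2 i with d′-binomial i | d″-binomial i
... | c , d′≈p | e , d″≈q with eventually-× d′≈p d″≈q
...   | t₀ , both = t₀ , c , e , both
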